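{- For any positive integer $g$, \[ t_g \geq F_{g+1} + \sum_{k = 1}^{\lfloor g/3\rfloor} \sum_{A \in \mathcal A_k} F_{g - |(A + A)\cap[0, k]| + |A| - k - 1}. \]
   Context: A numerical semigroup is a subset $\Lambda\subset\mathbb{N}_0$ closed under addition, containing $0$, with finite complement in $\mathbb{N}_0$; its multiplicity $m(\Lambda)$ is its smallest nonzero element, its Frobenius number $f(\Lambda)$ is the largest element of $\mathbb{N}_0\setminus\Lambda$, and its genus is $|\mathbb{N}_0\setminus\Lambda|$. $t_g$ denotes the number of numerical semigroups $\Lambda$ of genus $g$ with $f(\Lambda)<3m(\Lambda)$. For integers $a\le b$, $[a,b]=\{a,\dots,b\}$; $A+A=\{a_1+a_2:a_1,a_2\in A\}$. For a positive integer $k$, $\mathcal A_k=\{A\subset[0,k-1]: 0\in A,\ k\notin A+A\}$. $F_n$ are the Fibonacci numbers, $F_1=F_2=1$, $F_{n+2}=F_{n+1}+F_n$, with the convention $F_n=0$ for all $n\le 0$. -}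

module Defs where

open import Data.Nat using (ℕ; zero; suc; _+_; _*_; _<_; _≤_; _≥_; _/_)
open import Data.Nat.Base using (_≡ᵇ_)
open import Data.Bool using (Bool; true; false; if_then_else_; _∧_; not)
open import Data.Integer as ℤ using (ℤ; +_; -[1+_])
open import Data.List using (List; []; _∷_; _++_; map; length; upTo; filter)
open import Data.Bool.ListAction using (any)
open import Data.Nat.ListAction using (sum)
open import Data.List.Membership.Propositional using (_∈_)
open import Data.List.Relation.Unary.Unique.Propositional using (Unique)
open import Data.Product using (Σ; _×_; ∃)
open import Relation.Binary.PropositionalEquality using (_≡_; _≢_)
open import Relation.Nullary using (¬_)
open import Relation.Nullary.Decidable using (T?)

Subsetℕ : Set
Subsetℕ = ℕ → Bool

IsSubmonoid : Subsetℕ → Set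
IsSubmonoid Λ = (Λ 0 ≡ true) × (∀ a b → Λ a ≡ true → Λ b ≡ true → Λ (a + b) ≡ true)

HasGenus : Subsetℕ → ℕ → Set
HasGenus Λ g = Σ (List ℕ) λ G →
  Unique G × (length G ≡ g) × (∀ n → n ∈ G → Λ n ≡ false) × (∀ n → Λ n ≡ false → n ∈ G)

-- numerical semigroup of genus g (finite complement is implied by HasGenus)
IsNumSemigroupOfGenus : Subsetℕ → ℕ → Set
IsNumSemigroupOfGenus Λ g = IsSubmonoid Λ × HasGenus Λ g

IsMultiplicity : Subsetℕ → ℕ → Set
IsMultiplicity Λ m = (1 ≤ m) × (Λ m ≡ true) × (∀ k → 1 ≤ k → k < m → Λ k ≡ false)

IsFrobenius : Subsetℕ → ℕ → Set
IsFrobenius Λ f = (Λ f ≡ false) × (∀ n → f < n → Λ n ≡ true)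

CountedBy-t : ℕ → Subsetℕ → Set
CountedBy-t g Λ = IsNumSemigroupOfGenus Λ g ×
  Σ ℕ λ m → Σ ℕ λ f → IsMultiplicity Λ m × IsFrobenius Λ f × (f < 3 * m)

Different : Subsetℕ → Subsetℕ → Set
Different Λ Λ' = ∃ λ n → Λ n ≢ Λ' n

-- Fibonacci numbers, F_0 = 0, F_1 = F_2 = 1, and F_n = 0 for n ≤ 0.

fib : ℕ → ℕ
fib zero = 0
fib (suc zero) = 1
fib (suc (suc n)) = fib (suc n) + fib n

fibℤ : ℤ → ℕ
fibℤ (+ n) = fib n
fibℤ -[1+ n ] = 0

subsets : List ℕ → List (List ℕ)
subsets [] = [] ∷ []
subsets (x ∷ xs) = subsets xs ++ map (x ∷_) (subsets xs)

_∈ᵇ_ : ℕ → List ℕ → Bool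
n ∈ᵇ A = any (λ a → a ≡ᵇ n) A

inSumsetᵇ : List ℕ → ℕ → Bool
inSumsetᵇ A n = any (λ a → any (λ b → (a + b) ≡ᵇ n) A) A

-- 𝒜_k = { A ⊆ [0,k-1] : 0 ∈ A, k ∉ A + A }   (upTo k = [0, …, k-1])
𝒜 : ℕ → List (List ℕ)
𝒜 k = filter (λ A → T? ((0 ∈ᵇ A) ∧ not (inSumsetᵇ A k))) (subsets (upTo k))

sumsetCount : List ℕ → ℕ → ℕ
sumsetCount A k = length (filter (λ n → T? (inSumsetᵇ A n)) (upTo (suc k)))

index : ℕ → ℕ → List ℕ → ℤ
index g k A = ((((+ g) ℤ.- (+ sumsetCount A k)) ℤ.+ (+ length A)) ℤ.- (+ k)) ℤ.- (+ 1)

lowerBound : ℕ → ℕ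
lowerBound g = fib (suc g) +
  sum (map (λ k → sum (map (λ A → fibℤ (index g k A)) (𝒜 k)))
           (map suc (upTo (g / 3))))

-- A numerical semigroup Λ with multiplicity m and f(Λ) < 3m is determined by
-- its traces on [m, 2m) and [2m, 3m), and such a pair of traces comes from a
-- semigroup as soon as the first contains m and the second contains every
-- sum of two elements of the first that falls below 3m.  Two families of
-- trace pairs give the bound.  If [2m, 3m) ⊆ Λ, the trace on (m, 2m) is free
-- and amounts to a composition of g into parts 1 and 2: F_{g+1} semigroups.
-- For 1 ≤ k ≤ g/3 and A ∈ 𝒜_k, let m + k and 2m + k be gaps, let m + A be
-- the trace on [m, m + k), and put 2m + ((A + A) ∩ [0, k)) and [2m + k, 3m)
-- into Λ.  The remaining positions of (m + k, 2m) and [2m, 2m + k) are free;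
-- summing Fibonacci numbers over the choices on [2m, 2m + k) leaves
-- F_{g - |(A+A) ∩ [0,k]| + |A| - k - 1} semigroups.  Semigroups built from
-- different families, levels k or sets A differ in their traces.

module Submission where

open import Defs
open import Data.Nat using (ℕ; _≤_)
open import Data.List using (List; length)
open import Data.List.Relation.Unary.All using (All)
open import Data.List.Relation.Unary.AllPairs using (AllPairs)
open import Data.Product using (Σ; _×_)

open import Data.Bool using (Bool; true; false; T; not; _∧_) renaming (_≟_ to _≟ᵇ_)
open import Data.Bool.Properties using (T-≡; ¬-not)
open import Data.Empty using (⊥; ⊥-elim)
open import Data.Integer as ℤ using (+_)
import Data.Integer.Properties as ℤ
open import Data.Integer.Tactic.RingSolver using (solve-∀)
open import Data.Nat.Tactic.RingSolver using () renaming (solve-∀ to solve-∀ⁿ)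
open import Data.List
  using ([]; _∷_; _++_; map; replicate; concatMap; filter; upTo; applyUpTo; head)
open import Data.List.Properties
  using (length-++; length-map; length-replicate; length-upTo; map-++; map-∘; upTo-∷ʳ;
         ∷-injective; ∷-injectiveˡ; ∷-injectiveʳ; ++-cancelˡ; ++-cancelʳ)
open import Data.List.Membership.Propositional using (_∈_)
open import Data.List.Membership.Propositional.Properties
  using (∈-map⁺; ∈-map⁻; ∈-++⁻; ∈-filter⁻)
import Data.List.Relation.Unary.Any as Any
open import Data.List.Relation.Unary.Any using (here; there)
open import Data.List.Relation.Unary.Any.Properties using (any⁺; any⁻)
import Data.List.Relation.Unary.All as All
import Data.List.Relation.Unary.All.Properties as All
open import Data.List.Relation.Unary.AllPairs using ([]; _∷_)
open import Data.List.Relation.Unary.All using ([]; _∷_)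
import Data.List.Relation.Unary.AllPairs.Properties as AllPairs
open import Data.List.Relation.Unary.Unique.Propositional using (Unique)
import Data.List.Relation.Unary.Unique.Propositional.Properties as Unique
open import Data.Maybe using (just)
open import Data.Nat
  using (zero; suc; pred; _+_; _*_; _∸_; _<_; _/_; z≤n; s≤s)
open import Data.Nat.DivMod using (m/n*n≤m)
open import Data.Nat.ListAction using (sum)
open import Data.Nat.Properties
open import Data.Product using (_,_; proj₁; proj₂; ∃; map₁)
open import Data.Sum using (inj₁; inj₂)
open import Function using (id; _∘_; Equivalence)
open import Relation.Binary.PropositionalEquality
open import Relation.Binary.Definitions using (tri<; tri≈; tri>)
open import Relation.Unary using (Decidable)
open import Relation.Nullary using (¬_; Dec; yes; no; does; contradiction)
open import Relation.Nullary.Decidable using (T?)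

true≢false : true ≢ false
true≢false ()

++-injective : ∀ {A : Set} (xs ys : List A) {zs ws} →
  length xs ≡ length ys → xs ++ zs ≡ ys ++ ws → xs ≡ ys × zs ≡ ws
++-injective []       []       _   eq = refl , eq
++-injective (x ∷ xs) (y ∷ ys) len eq with ∷-injective eq
... | refl , eq′ with ++-injective xs ys (suc-injective len) eq′
...   | refl , refl = refl , refl

filter-map : ∀ {A B : Set} {P : B → Set} (P? : Decidable P) (f : A → B) xs →
  filter P? (map f xs) ≡ map f (filter (P? ∘ f) xs)
filter-map P? f []       = refl
filter-map P? f (x ∷ xs) with does (P? (f x))
... | true  = cong (f x ∷_) (filter-map P? f xs)
... | false = filter-map P? f xs

length-map++map : ∀ {A B C : Set} (f : A → C) (g : B → C) xs ys →
  length (map f xs ++ map g ys) ≡ length xs + length ys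
length-map++map f g xs ys =
  trans (length-++ (map f xs)) (cong₂ _+_ (length-map f xs) (length-map g ys))

Unique-map++map : ∀ {A B : Set} {f g : A → B} →
  (∀ {x y} → f x ≡ f y → x ≡ y) → (∀ {x y} → g x ≡ g y → x ≡ y) →
  (∀ x y → f x ≢ g y) →
  ∀ {xs ys} → Unique xs → Unique ys → Unique (map f xs ++ map g ys)
Unique-map++map {f = f} {g} f-inj g-inj f≢g xs! ys! =
  Unique.++⁺ (Unique.map⁺ f-inj xs!) (Unique.map⁺ g-inj ys!) disjoint
  where
  disjoint : ∀ {v} → v ∈ map f _ × v ∈ map g _ → ⊥
  disjoint (v∈f , v∈g) with ∈-map⁻ f v∈f | ∈-map⁻ g v∈g
  ... | x , _ , refl | y , _ , fx≡gy = f≢g x y fx≡gy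

Unique-concatMap⁺ : ∀ {A B : Set} (F : A → List B) (K : A → B → Set) →
  (∀ {x y z} → K x z → K y z → x ≡ y) → ∀ {xs} → Unique xs →
  All (λ x → Unique (F x) × All (K x) (F x)) xs → Unique (concatMap F xs)
Unique-concatMap⁺ F K key {[]}     []           []                  = []
Unique-concatMap⁺ F K key {x ∷ xs} (x∉xs ∷ xs!) ((Fx! , Kx) ∷ info) =
  Unique.++⁺ Fx! (Unique-concatMap⁺ F K key xs! info) λ (z∈Fx , z∈rest) →
    All.lookup notKeyedByX z∈rest (All.lookup Kx z∈Fx)
  where
  notKeyedByX : All (λ z → ¬ K x z) (concatMap F xs)
  notKeyedByX = All.concat⁺ (All.map⁺ (All.zipWith
    (λ (x≢y , _ , Ky) → All.map (λ Kyz Kxz → x≢y (key Kxz Kyz)) Ky) (x∉xs , info)))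

sum-map≤length-concatMap : ∀ {A B : Set} (h : A → ℕ) (F : A → List B) {xs} →
  All (λ x → h x ≤ length (F x)) xs → sum (map h xs) ≤ length (concatMap F xs)
sum-map≤length-concatMap h F []                   = z≤n
sum-map≤length-concatMap h F {x ∷ _} (hx≤ ∷ rest) =
  subst (_ ≤_) (sym (length-++ (F x))) (+-mono-≤ hx≤ (sum-map≤length-concatMap h F rest))

-- Subsets of ℕ with finitely many gaps

cofinite : List Bool → Subsetℕ
cofinite []       _       = true
cofinite (x ∷ xs) zero    = x
cofinite (x ∷ xs) (suc n) = cofinite xs n

falses : List Bool → ℕ
falses []           = 0
falses (true ∷ xs)  = falses xs
falses (false ∷ xs) = suc (falses xs)

trues : List Bool → ℕ
trues []           = 0
trues (true ∷ xs)  = suc (trues xs)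
trues (false ∷ xs) = trues xs

trues+falses≡length : ∀ xs → trues xs + falses xs ≡ length xs
trues+falses≡length []           = refl
trues+falses≡length (true ∷ xs)  = cong suc (trues+falses≡length xs)
trues+falses≡length (false ∷ xs) =
  trans (+-suc (trues xs) (falses xs)) (cong suc (trues+falses≡length xs))

falses≤length : ∀ xs → falses xs ≤ length xs
falses≤length xs =
  ≤-trans (m≤n+m (falses xs) (trues xs)) (≤-reflexive (trues+falses≡length xs))

falses<length : ∀ w → head w ≡ just true → falses w < length w
falses<length (true ∷ w) refl = s≤s (falses≤length w)

falses-++ : ∀ xs ys → falses (xs ++ ys) ≡ falses xs + falses ys
falses-++ []           ys = refl
falses-++ (true ∷ xs)  ys = falses-++ xs ys
falses-++ (false ∷ xs) ys = cong suc (falses-++ xs ys)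

trues-++ : ∀ xs ys → trues (xs ++ ys) ≡ trues xs + trues ys
trues-++ []           ys = refl
trues-++ (true ∷ xs)  ys = cong suc (trues-++ xs ys)
trues-++ (false ∷ xs) ys = trues-++ xs ys

falses-replicate-false : ∀ r → falses (replicate r false) ≡ r
falses-replicate-false zero    = refl
falses-replicate-false (suc r) = cong suc (falses-replicate-false r)

falses-replicate-true : ∀ r → falses (replicate r true) ≡ 0
falses-replicate-true zero    = refl
falses-replicate-true (suc r) = falses-replicate-true r

length-filter-T : ∀ (h : ℕ → Bool) xs → length (filter (T? ∘ h) xs) ≡ trues (map h xs)
length-filter-T h []       = refl
length-filter-T h (x ∷ xs) with h x
... | true  = cong suc (length-filter-T h xs)
... | false = length-filter-T h xs

cofinite-++ˡ : ∀ xs ys {n} → n < length xs → cofinite (xs ++ ys) n ≡ cofinite xs n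
cofinite-++ˡ (x ∷ xs) ys {zero}  _         = refl
cofinite-++ˡ (x ∷ xs) ys {suc n} (s≤s n<) = cofinite-++ˡ xs ys n<

cofinite-++ʳ : ∀ xs ys n → cofinite (xs ++ ys) (length xs + n) ≡ cofinite ys n
cofinite-++ʳ []       ys n = refl
cofinite-++ʳ (x ∷ xs) ys n = cofinite-++ʳ xs ys n

cofinite-beyond : ∀ xs {n} → length xs ≤ n → cofinite xs n ≡ true
cofinite-beyond []       _         = refl
cofinite-beyond (x ∷ xs) (s≤s len≤) = cofinite-beyond xs len≤

cofinite-replicate-true : ∀ r n → cofinite (replicate r true) n ≡ true
cofinite-replicate-true zero    n       = refl
cofinite-replicate-true (suc r) zero    = refl
cofinite-replicate-true (suc r) (suc n) = cofinite-replicate-true r n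

cofinite-replicate-false : ∀ r {n} → n < r → cofinite (replicate r false) n ≡ false
cofinite-replicate-false (suc r) {zero}  _        = refl
cofinite-replicate-false (suc r) {suc n} (s≤s n<r) = cofinite-replicate-false r n<r

cofinite-falses≡0 : ∀ xs → falses xs ≡ 0 → ∀ n → cofinite xs n ≡ true
cofinite-falses≡0 []          _ n       = refl
cofinite-falses≡0 (true ∷ xs) _ zero    = refl
cofinite-falses≡0 (true ∷ xs) p (suc n) = cofinite-falses≡0 xs p n

cofinite-map-applyUpTo : ∀ (h : ℕ → Bool) (f : ℕ → ℕ) n {i} → i < n →
  cofinite (map h (applyUpTo f n)) i ≡ h (f i)
cofinite-map-applyUpTo h f (suc n) {zero}  _         = refl
cofinite-map-applyUpTo h f (suc n) {suc i} (s≤s i<n) = cofinite-map-applyUpTo h (f ∘ suc) n i<n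

cofinite-after-gap : ∀ d r {n} → length d < n →
  cofinite (d ++ false ∷ replicate r true) n ≡ true
cofinite-after-gap []      r {suc n} _          = cofinite-replicate-true r n
cofinite-after-gap (x ∷ d) r {suc n} (s≤s d<n) = cofinite-after-gap d r d<n

cofinite-at-gap : ∀ w c → cofinite (w ++ false ∷ c) (length w) ≡ false
cofinite-at-gap w c =
  trans (cong (cofinite (w ++ false ∷ c)) (sym (+-identityʳ (length w))))
        (cofinite-++ʳ w (false ∷ c) 0)

gaps : List Bool → List ℕ
gaps []           = []
gaps (true ∷ xs)  = map suc (gaps xs)
gaps (false ∷ xs) = 0 ∷ map suc (gaps xs)

cofinite-hasGenus : ∀ xs → HasGenus (cofinite xs) (falses xs)
cofinite-hasGenus xs = gaps xs , gaps-unique xs , length-gaps xs , ∈-gaps⇒ xs , ⇒∈-gaps xs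
  where
  length-gaps : ∀ xs → length (gaps xs) ≡ falses xs
  length-gaps []           = refl
  length-gaps (true ∷ xs)  = trans (length-map suc (gaps xs)) (length-gaps xs)
  length-gaps (false ∷ xs) = cong suc (trans (length-map suc (gaps xs)) (length-gaps xs))

  gaps-unique : ∀ xs → Unique (gaps xs)
  gaps-unique []           = []
  gaps-unique (true ∷ xs)  = Unique.map⁺ suc-injective (gaps-unique xs)
  gaps-unique (false ∷ xs) =
    All.map⁺ (All.universal (λ _ ()) (gaps xs)) ∷ Unique.map⁺ suc-injective (gaps-unique xs)

  ∈-gaps⇒ : ∀ xs n → n ∈ gaps xs → cofinite xs n ≡ false
  ∈-gaps⇒ (true ∷ xs) n n∈ with ∈-map⁻ suc n∈
  ... | k , k∈ , refl = ∈-gaps⇒ xs k k∈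
  ∈-gaps⇒ (false ∷ xs) .0 (here refl) = refl
  ∈-gaps⇒ (false ∷ xs) n (there n∈) with ∈-map⁻ suc n∈
  ... | k , k∈ , refl = ∈-gaps⇒ xs k k∈

  ⇒∈-gaps : ∀ xs n → cofinite xs n ≡ false → n ∈ gaps xs
  ⇒∈-gaps (true ∷ xs)  (suc n) p = ∈-map⁺ suc (⇒∈-gaps xs n p)
  ⇒∈-gaps (false ∷ xs) zero    p = here refl
  ⇒∈-gaps (false ∷ xs) (suc n) p = there (∈-map⁺ suc (⇒∈-gaps xs n p))

cofinite-frobenius : ∀ xs → 1 ≤ falses xs →
  ∃ λ f → IsFrobenius (cofinite xs) f × f < length xs
cofinite-frobenius (x ∷ xs) 1≤ with falses xs ≟ 0
cofinite-frobenius (false ∷ xs) _ | yes none =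
  0 , (refl , λ { (suc n) _ → cofinite-falses≡0 xs none n }) , s≤s z≤n
cofinite-frobenius (true ∷ xs) 1≤ | yes none = contradiction (subst (1 ≤_) none 1≤) λ ()
cofinite-frobenius (x ∷ xs) _ | no some with cofinite-frobenius xs (n≢0⇒n>0 some)
... | f , (gap , above) , f< = suc f , (gap , λ { (suc n) (s≤s f<n) → above n f<n }) , s≤s f<

cofinite-different : ∀ xs ys → length xs ≡ length ys → xs ≢ ys →
  Different (cofinite xs) (cofinite ys)
cofinite-different []       []       _   xs≢ys = ⊥-elim (xs≢ys refl)
cofinite-different (x ∷ xs) (y ∷ ys) len xs≢ys with x ≟ᵇ y
... | no x≢y  = 0 , x≢y
... | yes refl with cofinite-different xs ys (suc-injective len) (xs≢ys ∘ cong (x ∷_))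
...   | n , differs = suc n , differs

Different-sym : ∀ {Λ Λ′} → Different Λ Λ′ → Different Λ′ Λ
Different-sym (n , differs) = n , differs ∘ sym

multiplicity<⇒different : ∀ {Λ Λ′ m m′} →
  IsMultiplicity Λ m → IsMultiplicity Λ′ m′ → m < m′ → Different Λ Λ′
multiplicity<⇒different (1≤m , m∈Λ , _) (_ , _ , below′) m<m′ =
  _ , λ eq → true≢false (trans (sym m∈Λ) (trans eq (below′ _ 1≤m m<m′)))

nonzero⇒multiplicity≤ : ∀ {Λ m n} → IsMultiplicity Λ m → 1 ≤ n → Λ n ≡ true → m ≤ n
nonzero⇒multiplicity≤ (_ , _ , below) 1≤n n∈Λ =
  ≮⇒≥ λ n<m → true≢false (trans (sym n∈Λ) (below _ 1≤n n<m))

-- A semigroup with multiplicity m and Frobenius number below 3m is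
-- determined by its traces a and b on [m, 2m) and [2m, 3m); m = length a.
Code : Set
Code = List Bool × List Bool

window : Code → List Bool
window (a , b) = true ∷ replicate (pred (length a)) false ++ a ++ b

semigroupOf : Code → Subsetℕ
semigroupOf c = cofinite (window c)

-- Below 3m the only sums of nonzero elements are sums of two elements of
-- [m, 2m) landing in [2m, 3m).
SumClosed : List Bool → List Bool → Set
SumClosed a b = ∀ i j → i + j < length a →
  cofinite a i ≡ true → cofinite a j ≡ true → cofinite b (i + j) ≡ true

WellFormed : Code → Set
WellFormed (a , b) = head a ≡ just true × length b ≡ length a × SumClosed a b

length-window : ∀ x a b →
  length (window (x ∷ a , b)) ≡ length (x ∷ a) + (length (x ∷ a) + length b)
length-window x a b = cong suc (begin
  length (replicate (length a) false ++ x ∷ a ++ b)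
    ≡⟨ length-++ (replicate (length a) false) ⟩
  length (replicate (length a) false) + suc (length (a ++ b))
    ≡⟨ cong₂ (λ r s → r + suc s) (length-replicate (length a)) (length-++ a) ⟩
  length a + suc (length a + length b) ∎)
  where open ≡-Reasoning

length-window≡3m : ∀ a b → head a ≡ just true → length b ≡ length a →
  length (window (a , b)) ≡ 3 * length a
length-window≡3m (true ∷ a) b refl len =
  trans (length-window true a b) (cong (λ l → m + (m + l)) (trans len (sym (+-identityʳ m))))
  where m = suc (length a)

falses-window : ∀ x a b → falses (window (x ∷ a , b)) ≡ length a + falses (x ∷ a ++ b)
falses-window x a b =
  trans (falses-++ (replicate (length a) false) (x ∷ a ++ b))
        (cong (_+ falses (x ∷ a ++ b)) (falses-replicate-false (length a)))

semigroupOf-below : ∀ a b {n} → 1 ≤ n → n < length a → semigroupOf (a , b) n ≡ false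
semigroupOf-below (x ∷ a) b {suc n} _ (s≤s n<) = begin
  cofinite (replicate (length a) false ++ x ∷ a ++ b) n
    ≡⟨ cofinite-++ˡ (replicate (length a) false) _ (subst (n <_) (sym (length-replicate _)) n<) ⟩
  cofinite (replicate (length a) false) n
    ≡⟨ cofinite-replicate-false (length a) n< ⟩
  false ∎
  where open ≡-Reasoning

semigroupOf-above : ∀ x a b i →
  semigroupOf (x ∷ a , b) (length (x ∷ a) + i) ≡ cofinite (x ∷ a ++ b) i
semigroupOf-above x a b i =
  subst (λ r → cofinite (replicate (length a) false ++ x ∷ a ++ b) (r + i) ≡ cofinite (x ∷ a ++ b) i)
        (length-replicate (length a))
        (cofinite-++ʳ (replicate (length a) false) (x ∷ a ++ b) i)

semigroupOf-multiplicity : ∀ a b → head a ≡ just true →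
  IsMultiplicity (semigroupOf (a , b)) (length a)
semigroupOf-multiplicity (true ∷ a) b refl =
    s≤s z≤n
  , subst (λ n → semigroupOf (true ∷ a , b) n ≡ true) (+-identityʳ (suc (length a)))
          (semigroupOf-above true a b 0)
  , λ _ → semigroupOf-below (true ∷ a) b

semigroupOf-closed : ∀ c → WellFormed c → ∀ u v →
  semigroupOf c u ≡ true → semigroupOf c v ≡ true → semigroupOf c (u + v) ≡ true
semigroupOf-closed (true ∷ a , b) (refl , len , closed) = closure
  where
  m = suc (length a)
  S = semigroupOf (true ∷ a , b)

  middle : ∀ i → i < m → S (m + i) ≡ cofinite (true ∷ a) i
  middle i i<m = trans (semigroupOf-above true a b i) (cofinite-++ˡ (true ∷ a) b i<m)

  top : ∀ i → S (m + (m + i)) ≡ cofinite b i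
  top i = trans (semigroupOf-above true a b (m + i)) (cofinite-++ʳ (true ∷ a) b i)

  beyond : ∀ {n} → m + (m + m) ≤ n → S n ≡ true
  beyond {n} = cofinite-beyond _ ∘ subst (_≤ n) (sym length≡)
    where length≡ = trans (length-window true a b) (cong (λ l → m + (m + l)) len)

  multiplicity≤ : ∀ {n} → S (suc n) ≡ true → m ≤ suc n
  multiplicity≤ = nonzero⇒multiplicity≤ (semigroupOf-multiplicity (true ∷ a) b refl) (s≤s z≤n)

  regroup : ∀ i j → (m + i) + (m + j) ≡ m + (m + (i + j))
  regroup = solve-∀ⁿ

  shifted : ∀ i j → S (m + i) ≡ true → S (m + j) ≡ true → S ((m + i) + (m + j)) ≡ true
  shifted i j i∈ j∈ = subst (λ n → S n ≡ true) (sym (regroup i j)) (sum∈ (i + j <? m))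
    where
    sum∈ : Dec (i + j < m) → S (m + (m + (i + j))) ≡ true
    sum∈ (yes i+j<m) = trans (top (i + j)) (closed i j i+j<m
      (trans (sym (middle i (≤-<-trans (m≤m+n i j) i+j<m))) i∈)
      (trans (sym (middle j (≤-<-trans (m≤n+m j i) i+j<m))) j∈))
    sum∈ (no i+j≮m) = beyond (+-monoʳ-≤ m (+-monoʳ-≤ m (≮⇒≥ i+j≮m)))

  closure : ∀ u v → S u ≡ true → S v ≡ true → S (u + v) ≡ true
  closure zero    v       _  v∈ = v∈
  closure (suc u) zero    u∈ _  = subst (λ n → S n ≡ true) (sym (+-identityʳ (suc u))) u∈
  closure (suc u) (suc v) u∈ v∈
    with m≤n⇒∃[o]m+o≡n (multiplicity≤ u∈) | m≤n⇒∃[o]m+o≡n (multiplicity≤ v∈)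
  ... | i , refl | j , refl = shifted i j u∈ v∈

semigroupOf-counted : ∀ {g} c → WellFormed c → falses (window c) ≡ g → 1 ≤ g →
  CountedBy-t g (semigroupOf c)
semigroupOf-counted c@(true ∷ a , b) wf@(refl , len , _) genus 1≤g
  with cofinite-frobenius (window c) (subst (1 ≤_) (sym genus) 1≤g)
... | f , frobenius , f<length =
    ( (refl , semigroupOf-closed c wf)
    , subst (HasGenus (semigroupOf c)) genus (cofinite-hasGenus (window c)))
  , length (true ∷ a) , f , semigroupOf-multiplicity (true ∷ a) b refl , frobenius
  , subst (f <_) (length-window≡3m (true ∷ a) b refl len) f<length

window-injective : ∀ a b a′ b′ → length a ≡ length a′ →
  window (a , b) ≡ window (a′ , b′) → (a , b) ≡ (a′ , b′)
window-injective a b a′ b′ len eq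
  with ++-injective (replicate (pred (length a)) false) (replicate (pred (length a′)) false)
                    (trans (length-replicate _) (trans (cong pred len) (sym (length-replicate _))))
                    (∷-injectiveʳ eq)
... | _ , eq′ with ++-injective a a′ len eq′
...   | refl , refl = refl

semigroupOf-different : ∀ c c′ → WellFormed c → WellFormed c′ → c ≢ c′ →
  Different (semigroupOf c) (semigroupOf c′)
semigroupOf-different (a , b) (a′ , b′) (hd , len , _) (hd′ , len′ , _) c≢c′
  with semigroupOf-multiplicity a b hd | semigroupOf-multiplicity a′ b′ hd′
     | <-cmp (length a) (length a′)
... | mult | mult′ | tri< m<m′ _ _ = multiplicity<⇒different mult mult′ m<m′
... | mult | mult′ | tri> _ _ m′<m = Different-sym (multiplicity<⇒different mult′ mult m′<m)
... | _    | _     | tri≈ _ m≡m′ _ =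
  cofinite-different (window (a , b)) (window (a′ , b′))
    (trans (length-window≡3m a b hd len)
           (trans (cong (3 *_) m≡m′) (sym (length-window≡3m a′ b′ hd′ len′))))
    (c≢c′ ∘ window-injective a b a′ b′ m≡m′)

semigroupOf-pairwiseDifferent : ∀ {cs} → Unique cs → All WellFormed cs →
  AllPairs (λ c c′ → Different (semigroupOf c) (semigroupOf c′)) cs
semigroupOf-pairwiseDifferent []           []         = []
semigroupOf-pairwiseDifferent (c∉cs ∷ cs!) (wf ∷ wfs) =
  All.zipWith (λ (c≢c′ , wf′) → semigroupOf-different _ _ wf wf′ c≢c′) (c∉cs , wfs)
  ∷ semigroupOf-pairwiseDifferent cs! wfs

-- Fibonacci-counted enumerations

-- Compositions of n ∸ 1 into parts 1 (true) and 2 (false).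
compositions : ℕ → List (List Bool)
compositions 0             = []
compositions 1             = [] ∷ []
compositions (suc (suc n)) =
  map (true ∷_) (compositions (suc n)) ++ map (false ∷_) (compositions n)

length-compositions : ∀ n → length (compositions n) ≡ fib n
length-compositions 0             = refl
length-compositions 1             = refl
length-compositions (suc (suc n)) =
  trans (length-map++map (true ∷_) (false ∷_) (compositions (suc n)) (compositions n))
        (cong₂ _+_ (length-compositions (suc n)) (length-compositions n))

compositions-unique : ∀ n → Unique (compositions n)
compositions-unique 0             = []
compositions-unique 1             = [] ∷ []
compositions-unique (suc (suc n)) =
  Unique-map++map ∷-injectiveʳ ∷-injectiveʳ (λ _ _ → true≢false ∘ ∷-injectiveˡ)
                  (compositions-unique (suc n)) (compositions-unique n)

∈-compositions⇒ : ∀ n {c} → c ∈ compositions n → n ≡ suc (length c + falses c)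
∈-compositions⇒ 1             (here refl) = refl
∈-compositions⇒ (suc (suc n)) c∈ with ∈-++⁻ (map (true ∷_) (compositions (suc n))) c∈
... | inj₁ c∈₁ with ∈-map⁻ (true ∷_) c∈₁
...   | c , c∈′ , refl = cong suc (∈-compositions⇒ (suc n) c∈′)
∈-compositions⇒ (suc (suc n)) c∈ | inj₂ c∈₂ with ∈-map⁻ (false ∷_) c∈₂
...   | c , c∈′ , refl =
  cong (suc ∘ suc) (trans (∈-compositions⇒ n c∈′) (sym (+-suc (length c) (falses c))))

Dominates : List Bool → List Bool → Set
Dominates u d = ∀ i → cofinite u i ≡ true → cofinite d i ≡ true

-- The pairs (d , c) with d as long as u and dominating it, and
-- c ∈ compositions (N ∸ falses d).
dominatingPairs : List Bool → ℕ → List (List Bool × List Bool)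
dominatingPairs []          N = map ([] ,_) (compositions N)
dominatingPairs (true ∷ u)  N = map (map₁ (true ∷_)) (dominatingPairs u N)
dominatingPairs (false ∷ u) N =
  map (map₁ (true ∷_)) (dominatingPairs u N) ++ map (map₁ (false ∷_)) (dominatingPairs u (pred N))

map₁-∷-injective : ∀ {b : Bool} {p q : List Bool × List Bool} →
  map₁ (b ∷_) p ≡ map₁ (b ∷_) q → p ≡ q
map₁-∷-injective {p = _ , _} {_ , _} refl = refl

length-dominatingPairs : ∀ u N → falses u ≤ N →
  length (dominatingPairs u N) ≡ fib (N + falses u)
length-dominatingPairs []          N       _         =
  trans (length-map ([] ,_) (compositions N))
        (trans (length-compositions N) (cong fib (sym (+-identityʳ N))))
length-dominatingPairs (true ∷ u)  N       u≤N       =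
  trans (length-map (map₁ (true ∷_)) (dominatingPairs u N)) (length-dominatingPairs u N u≤N)
length-dominatingPairs (false ∷ u) (suc N) (s≤s u≤N) = begin
  length (dominatingPairs (false ∷ u) (suc N))
    ≡⟨ length-map++map (map₁ (true ∷_)) (map₁ (false ∷_))
                       (dominatingPairs u (suc N)) (dominatingPairs u N) ⟩
  length (dominatingPairs u (suc N)) + length (dominatingPairs u N)
    ≡⟨ cong₂ _+_ (length-dominatingPairs u (suc N) (m≤n⇒m≤1+n u≤N))
                 (length-dominatingPairs u N u≤N) ⟩
  fib (suc N + falses u) + fib (N + falses u)
    ≡⟨ cong fib (+-suc (suc N) (falses u)) ⟨
  fib (suc N + suc (falses u)) ∎
  where open ≡-Reasoning

dominatingPairs-unique : ∀ u N → Unique (dominatingPairs u N)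
dominatingPairs-unique []          N = Unique.map⁺ (cong proj₂) (compositions-unique N)
dominatingPairs-unique (true ∷ u)  N = Unique.map⁺ map₁-∷-injective (dominatingPairs-unique u N)
dominatingPairs-unique (false ∷ u) N =
  Unique-map++map map₁-∷-injective map₁-∷-injective
                  (λ _ _ → true≢false ∘ ∷-injectiveˡ ∘ cong proj₁)
                  (dominatingPairs-unique u N) (dominatingPairs-unique u (pred N))

∈-dominatingPairs⇒ : ∀ u N {d c} → (d , c) ∈ dominatingPairs u N →
  length d ≡ length u × N ≡ suc (length c + falses c + falses d) × Dominates u d
∈-dominatingPairs⇒ [] N p∈ with ∈-map⁻ ([] ,_) p∈
... | c , c∈ , refl =
  refl , trans (∈-compositions⇒ N c∈) (cong suc (sym (+-identityʳ _))) , λ _ → id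
∈-dominatingPairs⇒ (true ∷ u) N p∈ with ∈-map⁻ (map₁ (true ∷_)) p∈
... | (d , c) , p∈′ , refl with ∈-dominatingPairs⇒ u N p∈′
...   | len , N≡ , dom = cong suc len , N≡ , λ { zero _ → refl ; (suc i) → dom i }
∈-dominatingPairs⇒ (false ∷ u) N p∈ with ∈-++⁻ (map (map₁ (true ∷_)) (dominatingPairs u N)) p∈
... | inj₁ p∈₁ with ∈-map⁻ (map₁ (true ∷_)) p∈₁
...   | (d , c) , p∈′ , refl with ∈-dominatingPairs⇒ u N p∈′
...     | len , N≡ , dom = cong suc len , N≡ , λ { zero () ; (suc i) → dom i }
∈-dominatingPairs⇒ (false ∷ u) N p∈ | inj₂ p∈₂ with ∈-map⁻ (map₁ (false ∷_)) p∈₂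
...   | (d , c) , p∈′ , refl with N | ∈-dominatingPairs⇒ u (pred N) p∈′
...     | suc N′ | len , N≡ , dom =
  cong suc len , cong suc (trans N≡ (sym (+-suc _ (falses d)))) , λ { zero () ; (suc i) → dom i }

-- Subsets as bit vectors

bitVectors : ℕ → List (List Bool)
bitVectors zero    = [] ∷ []
bitVectors (suc n) = map (false ∷_) (bitVectors n) ++ map (true ∷_) (bitVectors n)

bitVectors-unique : ∀ n → Unique (bitVectors n)
bitVectors-unique zero    = [] ∷ []
bitVectors-unique (suc n) =
  Unique-map++map ∷-injectiveʳ ∷-injectiveʳ (λ _ _ → true≢false ∘ sym ∘ ∷-injectiveˡ)
                  (bitVectors-unique n) (bitVectors-unique n)

∈-bitVectors⇒length : ∀ n {w} → w ∈ bitVectors n → length w ≡ n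
∈-bitVectors⇒length zero    (here refl) = refl
∈-bitVectors⇒length (suc n) w∈ with ∈-++⁻ (map (false ∷_) (bitVectors n)) w∈
... | inj₁ w∈₁ with ∈-map⁻ (false ∷_) w∈₁
...   | w , w∈′ , refl = cong suc (∈-bitVectors⇒length n w∈′)
∈-bitVectors⇒length (suc n) w∈ | inj₂ w∈₂ with ∈-map⁻ (true ∷_) w∈₂
...   | w , w∈′ , refl = cong suc (∈-bitVectors⇒length n w∈′)

select : List ℕ → List Bool → List ℕ
select []       _           = []
select (x ∷ xs) []          = []
select (x ∷ xs) (false ∷ w) = select xs w
select (x ∷ xs) (true ∷ w)  = x ∷ select xs w

subsets≡map-select : ∀ xs → subsets xs ≡ map (select xs) (bitVectors (length xs))
subsets≡map-select []       = refl
subsets≡map-select (x ∷ xs) = sym (begin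
  map (select (x ∷ xs)) (map (false ∷_) B ++ map (true ∷_) B)
    ≡⟨ map-++ (select (x ∷ xs)) (map (false ∷_) B) (map (true ∷_) B) ⟩
  map (select (x ∷ xs)) (map (false ∷_) B) ++ map (select (x ∷ xs)) (map (true ∷_) B)
    ≡⟨ cong₂ _++_ (sym (map-∘ B)) (sym (map-∘ B)) ⟩
  map (select xs) B ++ map ((x ∷_) ∘ select xs) B
    ≡⟨ cong (map (select xs) B ++_) (map-∘ B) ⟩
  map (select xs) B ++ map (x ∷_) (map (select xs) B)
    ≡⟨ cong (λ S → S ++ map (x ∷_) S) (sym (subsets≡map-select xs)) ⟩
  subsets xs ++ map (x ∷_) (subsets xs) ∎)
  where open ≡-Reasoning
        B = bitVectors (length xs)

length-select : ∀ xs w → length w ≡ length xs → length (select xs w) ≡ trues w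
length-select []       []          _   = refl
length-select (x ∷ xs) (false ∷ w) len = length-select xs w (suc-injective len)
length-select (x ∷ xs) (true ∷ w)  len = cong suc (length-select xs w (suc-injective len))

∈-select⁺ : ∀ (f : ℕ → ℕ) n w {i} → length w ≡ n → i < n → cofinite w i ≡ true →
  f i ∈ select (applyUpTo f n) w
∈-select⁺ f (suc n) (true ∷ w)  {zero}  _   _         _ = here refl
∈-select⁺ f (suc n) (true ∷ w)  {suc i} len (s≤s i<n) p =
  there (∈-select⁺ (f ∘ suc) n w (suc-injective len) i<n p)
∈-select⁺ f (suc n) (false ∷ w) {suc i} len (s≤s i<n) p =
  ∈-select⁺ (f ∘ suc) n w (suc-injective len) i<n p

∈-select⁻ : ∀ (f : ℕ → ℕ) n w {x} → x ∈ select (applyUpTo f n) w →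
  ∃ λ i → i < n × f i ≡ x × cofinite w i ≡ true
∈-select⁻ f (suc n) (true ∷ w) (here refl) = 0 , s≤s z≤n , refl , refl
∈-select⁻ f (suc n) (true ∷ w) (there x∈) with ∈-select⁻ (f ∘ suc) n w x∈
... | i , i<n , refl , p = suc i , s≤s i<n , refl , p
∈-select⁻ f (suc n) (false ∷ w) x∈ with ∈-select⁻ (f ∘ suc) n w x∈
... | i , i<n , refl , p = suc i , s≤s i<n , refl , p

∈ᵇ⇒∈ : ∀ {n} A → T (n ∈ᵇ A) → n ∈ A
∈ᵇ⇒∈ {n} A t = Any.map (λ {a} a≡ᵇn → sym (≡ᵇ⇒≡ a n a≡ᵇn)) (any⁻ _ A t)

inSumset⁺ : ∀ {A i j} → i ∈ A → j ∈ A → T (inSumsetᵇ A (i + j))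
inSumset⁺ {A} {i} {j} i∈ j∈ =
  any⁺ _ (Any.map (λ { refl → any⁺ _ (Any.map (λ { refl → ≡⇒≡ᵇ (i + j) (i + j) refl }) j∈) })
                  i∈)

sumsetIndicator : ℕ → List ℕ → List Bool
sumsetIndicator k A = map (inSumsetᵇ A) (upTo k)

length-sumsetIndicator : ∀ k A → length (sumsetIndicator k A) ≡ k
length-sumsetIndicator k A = trans (length-map _ (upTo k)) (length-upTo k)

sumsetCount≡trues : ∀ k A → ¬ T (inSumsetᵇ A k) →
  sumsetCount A k ≡ trues (sumsetIndicator k A)
sumsetCount≡trues k A k∉A+A = begin
  sumsetCount A k
    ≡⟨ length-filter-T (inSumsetᵇ A) (upTo (suc k)) ⟩
  trues (map (inSumsetᵇ A) (upTo (suc k)))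
    ≡⟨ cong (trues ∘ map (inSumsetᵇ A)) (upTo-∷ʳ k) ⟨
  trues (map (inSumsetᵇ A) (upTo k ++ k ∷ []))
    ≡⟨ cong trues (map-++ (inSumsetᵇ A) (upTo k) (k ∷ [])) ⟩
  trues (sumsetIndicator k A ++ inSumsetᵇ A k ∷ [])
    ≡⟨ trues-++ (sumsetIndicator k A) _ ⟩
  trues (sumsetIndicator k A) + trues (inSumsetᵇ A k ∷ [])
    ≡⟨ cong (λ b → trues (sumsetIndicator k A) + trues (b ∷ [])) k∉ ⟩
  trues (sumsetIndicator k A) + 0
    ≡⟨ +-identityʳ _ ⟩
  trues (sumsetIndicator k A) ∎
  where open ≡-Reasoning
        k∉ : inSumsetᵇ A k ≡ false
        k∉ = ¬-not (k∉A+A ∘ Equivalence.from T-≡)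

index≡ : ∀ g k A {x y N} →
  g ≡ suc (k + y) + N → sumsetCount A k + x ≡ k → length A + y ≡ k → index g k A ≡ + (N + x)
index≡ g k A {x} {y} {N} refl s+x≡k a+y≡k = begin
  (((+ (suc (k + y) + N) ℤ.- S) ℤ.+ + a) ℤ.- + k) ℤ.- + 1
    ≡⟨ cong (λ G → (((G ℤ.- S) ℤ.+ + a) ℤ.- + k) ℤ.- + 1) expand ⟩
  (((((+ 1 ℤ.+ (+ k ℤ.+ + y)) ℤ.+ + N) ℤ.- S) ℤ.+ + a) ℤ.- + k) ℤ.- + 1
    ≡⟨ collect (+ k) (+ y) (+ N) S (+ a) ⟩
  (+ N ℤ.+ (+ a ℤ.+ + y)) ℤ.- S
    ≡⟨ cong (λ t → (+ N ℤ.+ t) ℤ.- S) balance ⟩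
  (+ N ℤ.+ (S ℤ.+ + x)) ℤ.- S
    ≡⟨ cancel (+ N) S (+ x) ⟩
  + N ℤ.+ + x
    ≡⟨ ℤ.pos-+ N x ⟨
  + (N + x) ∎
  where
  open ≡-Reasoning
  s = sumsetCount A k
  a = length A
  S = + s

  expand : + (suc (k + y) + N) ≡ (+ 1 ℤ.+ (+ k ℤ.+ + y)) ℤ.+ + N
  expand = trans (ℤ.pos-+ (suc (k + y)) N) (cong (ℤ._+ + N)
                 (trans (ℤ.pos-+ 1 (k + y)) (cong (λ t → + 1 ℤ.+ t) (ℤ.pos-+ k y))))

  balance : + a ℤ.+ + y ≡ S ℤ.+ + x
  balance = trans (sym (ℤ.pos-+ a y)) (trans (cong +_ (trans a+y≡k (sym s+x≡k))) (ℤ.pos-+ s x))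

  collect : ∀ K Y N S A →
    (((((+ 1 ℤ.+ (K ℤ.+ Y)) ℤ.+ N) ℤ.- S) ℤ.+ A) ℤ.- K) ℤ.- + 1 ≡
    (N ℤ.+ (A ℤ.+ Y)) ℤ.- S
  collect = solve-∀

  cancel : ∀ N S X → (N ℤ.+ (S ℤ.+ X)) ℤ.- S ≡ N ℤ.+ X
  cancel = solve-∀

-- The two families of codes

OfGenus : ℕ → Code → Set
OfGenus g c = WellFormed c × falses (window c) ≡ g

fullCode : List Bool → Code
fullCode c = true ∷ c , replicate (suc (length c)) true

fullCode-good : ∀ g {c} → c ∈ compositions (suc g) → OfGenus g (fullCode c)
fullCode-good g {c} c∈ =
    (refl , length-replicate r , λ i j _ _ _ → cofinite-replicate-true r (i + j))
  , (begin
      falses (window (fullCode c))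
        ≡⟨ falses-window true c _ ⟩
      length c + falses (c ++ replicate r true)
        ≡⟨ cong (λ n → length c + n) (falses-++ c _) ⟩
      length c + (falses c + falses (replicate r true))
        ≡⟨ cong (λ n → length c + (falses c + n)) (falses-replicate-true r) ⟩
      length c + (falses c + 0)
        ≡⟨ cong (λ n → length c + n) (+-identityʳ _) ⟩
      length c + falses c
        ≡⟨ suc-injective (∈-compositions⇒ (suc g) c∈) ⟨
      g ∎)
  where open ≡-Reasoning
        r = suc (length c)

subsetOf : ℕ → List Bool → List ℕ
subsetOf k = select (upTo k)

admissible : ℕ → List ℕ → Bool
admissible k A = (0 ∈ᵇ A) ∧ not (inSumsetᵇ A k)

admissible⇒ : ∀ k A → T (admissible k A) → T (0 ∈ᵇ A) × ¬ T (inSumsetᵇ A k)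
admissible⇒ k A adm with 0 ∈ᵇ A | inSumsetᵇ A k
... | true | false = _ , λ ()

admissible⇒head : ∀ k w → length w ≡ k → T (admissible k (subsetOf k w)) →
  head w ≡ just true
admissible⇒head k w len adm
  with ∈-select⁻ id k w (∈ᵇ⇒∈ (subsetOf k w) (proj₁ (admissible⇒ k (subsetOf k w) adm)))
admissible⇒head k (x ∷ w) len  adm | .0 , _ , refl , refl = refl
admissible⇒head k []      refl adm | _ , () , _

-- The code of the semigroup with gaps m + k and 2m + k (its Frobenius
-- number), whose traces on [m, m + k), (m + k, 2m) and [2m, 2m + k) are
-- w, c and d; here k = length w.
gapCode : List Bool → List Bool × List Bool → Code
gapCode w (d , c) = w ++ false ∷ c , d ++ false ∷ replicate (length c) true

gapCode-support : ∀ w c {x} → x ≤ length w → cofinite (w ++ false ∷ c) x ≡ true →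
  x ∈ subsetOf (length w) w
gapCode-support w c {x} x≤ x∈ with m≤n⇒m<n∨m≡n x≤
... | inj₁ x<   =
  ∈-select⁺ id (length w) w refl x< (trans (sym (cofinite-++ˡ w (false ∷ c) x<)) x∈)
... | inj₂ refl = ⊥-elim (true≢false (trans (sym x∈) (cofinite-at-gap w c)))

gapCode-sumClosed : ∀ w d c → length d ≡ length w →
  ¬ T (inSumsetᵇ (subsetOf (length w) w) (length w)) →
  Dominates (sumsetIndicator (length w) (subsetOf (length w) w)) d →
  SumClosed (w ++ false ∷ c) (d ++ false ∷ replicate (length c) true)
gapCode-sumClosed w d c len k∉A+A dom i j _ i∈ j∈ with i + j ≤? length w
... | no  i+j≰k = cofinite-after-gap d (length c) (subst (_< i + j) (sym len) (≰⇒> i+j≰k))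
... | yes i+j≤k
  with m≤n⇒m<n∨m≡n i+j≤k
     | inSumset⁺ (gapCode-support w c (≤-trans (m≤m+n i j) i+j≤k) i∈)
                 (gapCode-support w c (≤-trans (m≤n+m j i) i+j≤k) j∈)
...   | inj₂ i+j≡k | i+j∈A+A =
  ⊥-elim (k∉A+A (subst (T ∘ inSumsetᵇ (subsetOf (length w) w)) i+j≡k i+j∈A+A))
...   | inj₁ i+j<k | i+j∈A+A = begin
  cofinite (d ++ false ∷ replicate (length c) true) (i + j)
    ≡⟨ cofinite-++ˡ d _ (subst (i + j <_) (sym len) i+j<k) ⟩
  cofinite d (i + j)
    ≡⟨ dom (i + j) (trans (cofinite-map-applyUpTo _ id (length w) i+j<k)
                          (Equivalence.to T-≡ i+j∈A+A)) ⟩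
  true ∎
  where open ≡-Reasoning

falses-window-gapCode : ∀ w d c → falses (window (gapCode (true ∷ w) (d , c))) ≡
  suc (length (true ∷ w) + falses w) + suc (length c + falses c + falses d)
falses-window-gapCode w d c = begin
  falses (window (gapCode (true ∷ w) (d , c)))
    ≡⟨ falses-window true (w ++ false ∷ c) b ⟩
  length (w ++ false ∷ c) + falses ((w ++ false ∷ c) ++ b)
    ≡⟨ cong₂ _+_ (length-++ w) (falses-++ (w ++ false ∷ c) b) ⟩
  (length w + suc (length c)) + (falses (w ++ false ∷ c) + falses b)
    ≡⟨ cong₂ (λ s t → (length w + suc (length c)) + (s + t))
             (falses-++ w (false ∷ c)) (falses-++ d (false ∷ replicate (length c) true)) ⟩
  (length w + suc (length c)) +
  ((falses w + suc (falses c)) + (falses d + suc (falses (replicate (length c) true))))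
    ≡⟨ cong (λ n → (length w + suc (length c)) +
                   ((falses w + suc (falses c)) + (falses d + suc n)))
            (falses-replicate-true (length c)) ⟩
  (length w + suc (length c)) + ((falses w + suc (falses c)) + (falses d + 1))
    ≡⟨ regroup (length w) (length c) (falses w) (falses c) (falses d) ⟩
  suc (suc (length w) + falses w) + suc (length c + falses c + falses d) ∎
  where
  open ≡-Reasoning
  b = d ++ false ∷ replicate (length c) true
  regroup : ∀ lw lc fw fc fd →
    (lw + suc lc) + ((fw + suc fc) + (fd + 1)) ≡ suc (suc lw + fw) + suc (lc + fc + fd)
  regroup = solve-∀ⁿ

gapCode-good : ∀ {g} w d c → head w ≡ just true → length d ≡ length w →
  ¬ T (inSumsetᵇ (subsetOf (length w) w) (length w)) →
  Dominates (sumsetIndicator (length w) (subsetOf (length w) w)) d →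
  g ≡ suc (length w + falses w) + suc (length c + falses c + falses d) →
  OfGenus g (gapCode w (d , c))
gapCode-good (true ∷ w) d c refl len k∉A+A dom genus =
    (refl , length-b≡length-a , gapCode-sumClosed (true ∷ w) d c len k∉A+A dom)
  , trans (falses-window-gapCode w d c) (sym genus)
  where
  length-b≡length-a :
    length (d ++ false ∷ replicate (length c) true) ≡ length (true ∷ w ++ false ∷ c)
  length-b≡length-a = begin
    length (d ++ false ∷ replicate (length c) true)
      ≡⟨ length-++ d ⟩
    length d + suc (length (replicate (length c) true))
      ≡⟨ cong₂ (λ s t → s + suc t) len (length-replicate (length c)) ⟩
    length (true ∷ w) + suc (length c)
      ≡⟨ cong suc (length-++ w) ⟨
    length (true ∷ w ++ false ∷ c) ∎
    where open ≡-Reasoning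

gapCode-injective : ∀ w {p q} → gapCode w p ≡ gapCode w q → p ≡ q
gapCode-injective w {d , c} {d′ , c′} eq with ∷-injectiveʳ (++-cancelˡ w _ _ (cong proj₁ eq))
... | refl = cong (_, c) (++-cancelʳ (false ∷ replicate (length c) true) d d′ (cong proj₂ eq))

LastGapAt : ℕ → List Bool → Set
LastGapAt k b = ∃ λ d → ∃ λ r → b ≡ d ++ false ∷ replicate r true × length d ≡ k

replicate-true-gapless : ∀ r d ys → replicate r true ≢ d ++ false ∷ ys
replicate-true-gapless zero    []      ys ()
replicate-true-gapless (suc r) []      ys ()
replicate-true-gapless (suc r) (x ∷ d) ys eq = replicate-true-gapless r d ys (∷-injectiveʳ eq)

LastGapAt-unique : ∀ {k k′ b} → LastGapAt k b → LastGapAt k′ b → k ≡ k′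
LastGapAt-unique (d , r , refl , refl) (d′ , r′ , eq , refl) = same-length d d′ eq
  where
  same-length : ∀ d d′ {r r′} →
    d ++ false ∷ replicate r true ≡ d′ ++ false ∷ replicate r′ true → length d ≡ length d′
  same-length []      []       eq = refl
  same-length []      (_ ∷ d′) eq = ⊥-elim (replicate-true-gapless _ d′ _ (∷-injectiveʳ eq))
  same-length (_ ∷ d) []       eq = ⊥-elim (replicate-true-gapless _ d _ (sym (∷-injectiveʳ eq)))
  same-length (_ ∷ d) (_ ∷ d′) eq = cong suc (same-length d d′ (∷-injectiveʳ eq))

codesFor : ℕ → ℕ → List Bool → List Code
codesFor g k w =
  map (gapCode w) (dominatingPairs (sumsetIndicator k (subsetOf k w)) (g ∸ suc (k + falses w)))

admissibleVectors : ℕ → List (List Bool)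
admissibleVectors k = filter (λ w → T? (admissible k (subsetOf k w))) (bitVectors k)

codesOfLevel : ℕ → ℕ → List Code
codesOfLevel g k = concatMap (codesFor g k) (admissibleVectors k)

∈-admissibleVectors⇒ : ∀ {k w} → w ∈ admissibleVectors k →
  length w ≡ k × T (admissible k (subsetOf k w))
∈-admissibleVectors⇒ {k} w∈ with ∈-filter⁻ (λ w → T? (admissible k (subsetOf k w))) w∈
... | w∈′ , adm = ∈-bitVectors⇒length k w∈′ , adm

genus-split : ∀ {g k f} → 3 * k ≤ g → f < k →
  g ≡ suc (k + f) + (g ∸ suc (k + f)) × k ≤ g ∸ suc (k + f)
genus-split {g} {k} {f} 3k≤g f<k =
    sym (m+[n∸m]≡n (≤-trans (m≤m+n _ k) fits))
  , subst (_≤ g ∸ suc (k + f)) (m+n∸m≡n (suc (k + f)) k) (∸-monoˡ-≤ (suc (k + f)) fits)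
  where
  k+k+k≡3*k : k + k + k ≡ 3 * k
  k+k+k≡3*k = solve-∀ⁿ′ k
    where solve-∀ⁿ′ : ∀ k → k + k + k ≡ 3 * k
          solve-∀ⁿ′ = solve-∀ⁿ

  fits : suc (k + f) + k ≤ g
  fits = begin
    suc (k + f) + k ≡⟨ cong (_+ k) (+-suc k f) ⟨
    k + suc f + k   ≤⟨ +-monoˡ-≤ k (+-monoʳ-≤ k f<k) ⟩
    k + k + k       ≡⟨ k+k+k≡3*k ⟩
    3 * k           ≤⟨ 3k≤g ⟩
    g               ∎
    where open ≤-Reasoning

codesFor-good : ∀ {g k w} → 3 * k ≤ g → w ∈ admissibleVectors k →
  All (OfGenus g) (codesFor g k w)
codesFor-good {g} {k} {w} 3k≤g w∈ with ∈-admissibleVectors⇒ {k} w∈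
... | refl , adm = All.map⁺ (All.tabulate good)
  where
  A = subsetOf (length w) w
  u = sumsetIndicator (length w) A
  N = g ∸ suc (length w + falses w)
  head≡ = admissible⇒head (length w) w refl adm
  g≡ = proj₁ (genus-split 3k≤g (falses<length w head≡))

  good : ∀ {p} → p ∈ dominatingPairs u N → OfGenus g (gapCode w p)
  good {d , c} p∈ with ∈-dominatingPairs⇒ u N p∈
  ... | len , N≡ , dom =
    gapCode-good w d c head≡ (trans len (length-sumsetIndicator (length w) A))
      (proj₂ (admissible⇒ (length w) A adm)) dom
      (trans g≡ (cong (λ n → suc (length w + falses w) + n) N≡))

fibℤ-index≡length-codesFor : ∀ {g k w} → 3 * k ≤ g → w ∈ admissibleVectors k →
  fibℤ (index g k (subsetOf k w)) ≡ length (codesFor g k w)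
fibℤ-index≡length-codesFor {g} {k} {w} 3k≤g w∈ with ∈-admissibleVectors⇒ {k} w∈
... | len , adm = begin
  fibℤ (index g k A)            ≡⟨ cong fibℤ (index≡ g k A g≡ s+x≡k a+y≡k) ⟩
  fib (N + falses u)            ≡⟨ length-dominatingPairs u N falses≤N ⟨
  length (dominatingPairs u N)  ≡⟨ length-map (gapCode w) (dominatingPairs u N) ⟨
  length (codesFor g k w)       ∎
  where
  open ≡-Reasoning
  A = subsetOf k w
  u = sumsetIndicator k A
  N = g ∸ suc (k + falses w)
  g≡,k≤N =
    genus-split 3k≤g (subst (falses w <_) len (falses<length w (admissible⇒head k w len adm)))
  g≡ = proj₁ g≡,k≤N

  s+x≡k : sumsetCount A k + falses u ≡ k
  s+x≡k = trans (cong (_+ falses u) (sumsetCount≡trues k A (proj₂ (admissible⇒ k A adm))))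
                (trans (trues+falses≡length u) (length-sumsetIndicator k A))

  a+y≡k : length A + falses w ≡ k
  a+y≡k = trans (cong (_+ falses w) (length-select (upTo k) w (trans len (sym (length-upTo k)))))
                (trans (trues+falses≡length w) len)

  falses≤N : falses u ≤ N
  falses≤N =
    ≤-trans (falses≤length u) (subst (_≤ N) (sym (length-sumsetIndicator k A)) (proj₂ g≡,k≤N))

levels : ℕ → List ℕ
levels g = map suc (upTo (g / 3))

codes : ℕ → List Code
codes g = map fullCode (compositions (suc g)) ++ concatMap (codesOfLevel g) (levels g)

3*level≤g : ∀ g → All (λ k → 3 * k ≤ g) (levels g)
3*level≤g g = All.map⁺ (All.applyUpTo⁺₁ id (g / 3) λ {i} i<g/3 → begin
  3 * suc i  ≡⟨ *-comm 3 (suc i) ⟩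
  suc i * 3  ≤⟨ *-monoˡ-≤ 3 i<g/3 ⟩
  g / 3 * 3  ≤⟨ m/n*n≤m g 3 ⟩
  g          ∎)
  where open ≤-Reasoning

codesOfLevel-good : ∀ {g k} → 3 * k ≤ g → All (OfGenus g) (codesOfLevel g k)
codesOfLevel-good {g} {k} 3k≤g =
  All.concat⁺ (All.map⁺ {xs = admissibleVectors k} (All.tabulate (codesFor-good {k = k} 3k≤g)))

codes-good : ∀ g → All (OfGenus g) (codes g)
codes-good g = All.++⁺ (All.map⁺ (All.tabulate (fullCode-good g)))
  (All.concat⁺ (All.map⁺ (All.map (λ {k} → codesOfLevel-good {g} {k}) (3*level≤g g))))

codesOfLevel-lastGap : ∀ g k → All (LastGapAt k ∘ proj₂) (codesOfLevel g k)
codesOfLevel-lastGap g k =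
  All.concat⁺ (All.map⁺ {xs = admissibleVectors k}
                        (All.universal (All.map⁺ ∘ All.tabulate ∘ lastGap) _))
  where
  lastGap : ∀ w {p} →
    p ∈ dominatingPairs (sumsetIndicator k (subsetOf k w)) (g ∸ suc (k + falses w)) →
    LastGapAt k (proj₂ (gapCode w p))
  lastGap w {d , c} p∈ = d , length c , refl ,
    trans (proj₁ (∈-dominatingPairs⇒ (sumsetIndicator k (subsetOf k w)) _ p∈))
          (length-sumsetIndicator k (subsetOf k w))

codesOfLevel-unique : ∀ g k → Unique (codesOfLevel g k)
codesOfLevel-unique g k =
  Unique-concatMap⁺ (codesFor g k) PrefixOfLength
    (λ {w} {w′} {code} → prefix-unique {w} {w′} {code})
    (Unique.filter⁺ _ (bitVectors-unique k))
    (All.tabulate λ {w} w∈ →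
        Unique.map⁺ (gapCode-injective w) (dominatingPairs-unique (sumsetIndicator k (subsetOf k w)) _)
      , All.map⁺ (All.universal (λ (d , c) → proj₁ (∈-admissibleVectors⇒ {k} w∈) , c , refl) _))
  where
  PrefixOfLength : List Bool → Code → Set
  PrefixOfLength w (a , _) = length w ≡ k × ∃ λ c → a ≡ w ++ false ∷ c

  prefix-unique : ∀ {w w′ code} → PrefixOfLength w code → PrefixOfLength w′ code → w ≡ w′
  prefix-unique (len , _ , refl) (len′ , _ , eq) =
    proj₁ (++-injective _ _ (trans len (sym len′)) eq)

codes-unique : ∀ g → Unique (codes g)
codes-unique g =
  Unique.++⁺ (Unique.map⁺ (∷-injectiveʳ ∘ cong proj₁) (compositions-unique (suc g)))
             levelled-unique disjoint
  where
  levelled-unique : Unique (concatMap (codesOfLevel g) (levels g))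
  levelled-unique =
    Unique-concatMap⁺ (codesOfLevel g) (λ k → LastGapAt k ∘ proj₂) LastGapAt-unique
    (Unique.map⁺ suc-injective (Unique.upTo⁺ (g / 3)))
    (All.universal (λ k → codesOfLevel-unique g k , codesOfLevel-lastGap g k) (levels g))

  gapped : All (λ code → ∃ λ k → LastGapAt k (proj₂ code)) (concatMap (codesOfLevel g) (levels g))
  gapped = All.concat⁺ (All.map⁺
    (All.universal (λ k → All.map (k ,_) (codesOfLevel-lastGap g k)) (levels g)))

  disjoint : ∀ {code} → code ∈ map fullCode (compositions (suc g)) ×
    code ∈ concatMap (codesOfLevel g) (levels g) → ⊥
  disjoint (full∈ , levelled∈) with ∈-map⁻ fullCode full∈ | All.lookup gapped levelled∈
  ... | c , _ , refl | _ , d , r , eq , _ = replicate-true-gapless _ d _ eq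

𝒜≡map-subsetOf : ∀ k → 𝒜 k ≡ map (subsetOf k) (admissibleVectors k)
𝒜≡map-subsetOf k = begin
  filter P? (subsets (upTo k))
    ≡⟨ cong (filter P?) (subsets≡map-select (upTo k)) ⟩
  filter P? (map (subsetOf k) (bitVectors (length (upTo k))))
    ≡⟨ cong (filter P? ∘ map (subsetOf k) ∘ bitVectors) (length-upTo k) ⟩
  filter P? (map (subsetOf k) (bitVectors k))
    ≡⟨ filter-map P? (subsetOf k) (bitVectors k) ⟩
  map (subsetOf k) (admissibleVectors k) ∎
  where open ≡-Reasoning
        P? = λ A → T? (admissible k A)

level-bound : ∀ {g k} → 3 * k ≤ g →
  sum (map (λ A → fibℤ (index g k A)) (𝒜 k)) ≤ length (codesOfLevel g k)
level-bound {g} {k} 3k≤g = begin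
  sum (map h (𝒜 k))
    ≡⟨ cong (sum ∘ map h) (𝒜≡map-subsetOf k) ⟩
  sum (map h (map (subsetOf k) (admissibleVectors k)))
    ≡⟨ cong sum (map-∘ (admissibleVectors k)) ⟨
  sum (map (h ∘ subsetOf k) (admissibleVectors k))
    ≤⟨ sum-map≤length-concatMap _ (codesFor g k)
         (All.tabulate (≤-reflexive ∘ fibℤ-index≡length-codesFor {k = k} 3k≤g)) ⟩
  length (codesOfLevel g k) ∎
  where open ≤-Reasoning
        h = λ A → fibℤ (index g k A)

lowerBound≤length-codes : ∀ g → lowerBound g ≤ length (codes g)
lowerBound≤length-codes g = begin
  lowerBound g
    ≤⟨ +-mono-≤ (≤-reflexive (sym (trans (length-map fullCode comps) (length-compositions (suc g)))))
                (sum-map≤length-concatMap _ (codesOfLevel g)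
                   (All.map (λ {k} → level-bound {g} {k}) (3*level≤g g))) ⟩
  length (map fullCode comps) + length (concatMap (codesOfLevel g) (levels g))
    ≡⟨ length-++ (map fullCode comps) ⟨
  length (codes g) ∎
  where open ≤-Reasoning
        comps = compositions (suc g)

lemma3p6 : (g : ℕ) → 1 ≤ g →
    Σ (List Subsetℕ) λ L →
    AllPairs Different L × All (CountedBy-t g) L × (lowerBound g ≤ length L)
lemma3p6 g 1≤g =
    map semigroupOf (codes g)
  , AllPairs.map⁺ (semigroupOf-pairwiseDifferent (codes-unique g) (All.map proj₁ good))
  , All.map⁺ (All.map (λ (wf , genus) → semigroupOf-counted _ wf genus 1≤g) good)
  , subst (lowerBound g ≤_) (sym (length-map semigroupOf (codes g))) (lowerBound≤length-codes g)
  where good = codes-good g
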